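{- Let $q$ be a formal variable (or a complex number with $|q|<1$). For $k\in\{0,1\}$ and every integer $n\geq 0$, \[ \sum_{j=-n-k}^{n}(-1)^j q^{j(5j+1)/2} =\sum_{r=0}^{n} e_{2r+k+2}\,(-1)^{n-r}q^{(n-r)(5n+3r+4k+5)/2}\frac{(q;q)_{n+r+k}}{(q;q)_{n-r}} \] and \[ \sum_{j=-n-k}^{n}(-1)^j q^{j(5j+3)/2} =\sum_{r=0}^{n} d_{2r+k+2}\,(-1)^{n-r}q^{(n-r)(5n+3r+4k+5)/2}\frac{(q;q)_{n+r+k}}{(q;q)_{n-r}}, \] where $e_n,d_n$ are the Schur polynomials described in the context.
   Context: For $n\geq 0$, $(a;q)_n=\prod_{j=0}^{n-1}(1-aq^j)$. The Schur polynomials $(e_n)_{n\geq 1}$ and $(d_n)_{n\geq 1}$ are defined by the recurrence $x_{n+2}=x_{n+1}+q^n x_n$ with initial conditions $e_1=e_2=1$, $d_1=0$, $d_2=1$. Equivalently, for $n\geq 2$, $e_n$ is the generating function $\sum_\lambda q^{|\lambda|}$ of partitions $\lambda$ whose parts differ pairwise by at least $2$ and whose largest part is at most $n-2$, and $d_n$ is the same generating function restricted additionally to partitions having no part equal to $1$. -}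

module Defs where

open import Level using (Level)
open import Algebra.Bundles using (CommutativeRing)
open import Data.Nat using (ℕ; zero; suc; _∸_) renaming (_+_ to _+ℕ_; _*_ to _*ℕ_; _/_ to _/ℕ_)
open import Data.Integer using (ℤ; +_; ∣_∣) renaming (_+_ to _+ℤ_; _*_ to _*ℤ_; -_ to -ℤ_)
open import Data.List using (List; []; _∷_; map; foldr)

zrange : ℤ → ℕ → List ℤ
zrange a zero = []
zrange a (suc len) = a ∷ zrange (a +ℤ + 1) len

nrange : ℕ → ℕ → List ℕ
nrange a zero = []
nrange a (suc len) = a ∷ nrange (suc a) len

module QDefs {c ℓ : Level} (R : CommutativeRing c ℓ) (q : CommutativeRing.Carrier R) where
  open CommutativeRing R

  pow : Carrier → ℕ → Carrier
  pow x zero = 1#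
  pow x (suc m) = x * pow x m

  qp : ℕ → Carrier
  qp = pow q

  sumL : List Carrier → Carrier
  sumL = foldr _+_ 0#

  prodL : List Carrier → Carrier
  prodL = foldr _*_ 1#

  poch : Carrier → ℕ → Carrier
  poch a n = prodL (map (λ j → 1# - a * qp j) (nrange 0 n))

  -- (q;q)_N / (q;q)_M for M ≤ N, i.e. ∏_{i=M+1}^{N} (1 - q^i) = (q^{M+1};q)_{N-M}
  qratio : ℕ → ℕ → Carrier
  qratio N M = poch (qp (suc M)) (N ∸ M)

  sgn : ℤ → Carrier
  sgn j = pow (- 1#) ∣ j ∣

  -- Schur polynomials: e_1 = e_2 = 1, d_1 = 0, d_2 = 1,
  -- x_{n+2} = x_{n+1} + q^n x_n  (n ≥ 1).  Index 0 is unused (set to 0).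
  schurE : ℕ → Carrier
  schurE zero = 0#
  schurE (suc zero) = 1#
  schurE (suc (suc zero)) = 1#
  schurE (suc (suc (suc m))) = schurE (suc (suc m)) + qp (suc m) * schurE (suc m)

  schurD : ℕ → Carrier
  schurD zero = 0#
  schurD (suc zero) = 0#
  schurD (suc (suc zero)) = 1#
  schurD (suc (suc (suc m))) = schurD (suc (suc m)) + qp (suc m) * schurD (suc m)

  -- Σ_{j=-n-k}^{n} (-1)^j q^{j(5j+b)/2}   (j(5j+b) ≥ 0 and even for b ∈ {1,3})
  lhsSum : ℕ → ℕ → ℕ → Carrier
  lhsSum b k n = sumL (map (λ j → sgn j * qp (∣ j *ℤ ((+ 5) *ℤ j +ℤ + b) ∣ /ℕ 2))
                           (zrange (-ℤ (+ (n +ℕ k))) (suc (n +ℕ (n +ℕ k)))))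

  rhsSum : (ℕ → Carrier) → ℕ → ℕ → Carrier
  rhsSum x k n = sumL (map (λ r →
      x (2 *ℕ r +ℕ k +ℕ 2) * pow (- 1#) (n ∸ r)
        * qp (((n ∸ r) *ℕ (5 *ℕ n +ℕ 3 *ℕ r +ℕ 4 *ℕ k +ℕ 5)) /ℕ 2)
        * qratio (n +ℕ r +ℕ k) (n ∸ r))
    (nrange 0 (suc n)))

{-# OPTIONS --safe #-}
module Submission where

-- Put u(i,J) = (-1)^i q^(i(5i+3+4J)/2) (q^(i+1);q)_J, v(i,J) = q^(2i+J+1) u(i,J),
-- α(m,J) = Σ_{i<m} (u(i,J) - v(i,J)) and β(m,J) = α(m,J) + u(m,J).  With m = n - r, the r-th
-- summand on the right is q^m u(m,2r+k) x_(2r+k+2).  One contiguous relation of u in each index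
-- yields
--   α(m+1,J) = β(m,J+1) + q^(J+2) α(m,J+2),
--   β(m+1,J) = α(m+1,J+1) + q^(J+2) β(m,J+2) + q^(m+1) u(m+1,J),
-- and together with x_(J+3) = x_(J+2) + q^(J+1) x_(J+1) these collapse the right side to
-- β(n,k) x_(k+2) + q^(k+1) α(n,k+1) x_(k+1).  On the left, the theta terms of index j ≥ 0 and
-- -j-1 are q-power multiples of u(j,0), and the symmetric partial theta sum telescopes to
-- β(n,0) for b = 3 and to β(n,0) + q α(n,1) for b = 1.  Comparing with x_1, x_2, x_3 for e and d
-- gives the four identities.

open import Level using (Level)
open import Algebra.Bundles using (CommutativeRing)
open import Algebra.Solver.Ring.AlmostCommutativeRing
  using (fromCommutativeRing; _-Raw-AlmostCommutative⟶_)
open import Data.Nat using (ℕ; zero; suc; _∸_; _≤_; z≤n; s≤s)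
import Data.Nat as ℕ
import Data.Nat.Properties as ℕₚ
open import Data.Nat.Divisibility using (divides-refl)
open import Data.Nat.DivMod using (+-distrib-/-∣ʳ; m*n/n≡m)
open import Data.Nat.Tactic.RingSolver using () renaming (solve to solveℕ)
open import Data.Integer using (ℤ; +_; -[1+_]; ∣_∣)
import Data.Integer as ℤ
import Data.Integer.Properties as ℤₚ
import Data.Sign as Sign
open import Data.List using ([]; _∷_; map)
import Data.Maybe as Maybe
open import Data.Product using (_×_; _,_)
open import Function using (_∘_; _∋_)
open import Relation.Binary.PropositionalEquality as ≡ using (_≡_)
open import Relation.Nullary.Decidable using (dec⇒maybe)
open import Defs

-- Algebra.Solver.Ring must decide equality of coefficients, which R itself does not allow;
-- integers, mapped to R by n ↦ n · 1#, serve as coefficients instead.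
module ℤ-Coefficients {c ℓ : Level} (R : CommutativeRing c ℓ) where
  open CommutativeRing R
  open import Algebra.Properties.Ring ring
    using (-0#≈0#; -‿involutive; -‿distribˡ-*; -‿distribʳ-*; -‿+-comm; xyx⁻¹≈y)
  open import Algebra.Properties.Semiring.Mult.TCOptimised semiring
    using (1+×; ×-homo-+; ×1-homo-*) renaming (_×_ to _×ᵣ_)
  open import Relation.Binary.Reasoning.Setoid setoid

  ι : ℕ → Carrier
  ι n = n ×ᵣ 1#

  ⟦_⟧ℤ : ℤ → Carrier
  ⟦ + n ⟧ℤ = ι n
  ⟦ -[1+ n ] ⟧ℤ = - ι (suc n)

  x≈x-0# : ∀ x → x ≈ x - 0#
  x≈x-0# x = sym (trans (+-congˡ -0#≈0#) (+-identityʳ x))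

  ⊖-homo : ∀ m n → ⟦ m ℤ.⊖ n ⟧ℤ ≈ ι m - ι n
  ⊖-homo zero zero = x≈x-0# 0#
  ⊖-homo zero (suc n) = sym (+-identityˡ _)
  ⊖-homo (suc m) zero = x≈x-0# _
  ⊖-homo (suc m) (suc n) = begin
    ⟦ suc m ℤ.⊖ suc n ⟧ℤ   ≡⟨ ≡.cong ⟦_⟧ℤ (ℤₚ.[1+m]⊖[1+n]≡m⊖n m n) ⟩
    ⟦ m ℤ.⊖ n ⟧ℤ           ≈⟨ ⊖-homo m n ⟩
    ι m - ι n               ≈⟨ ι-suc-cancel ⟨
    ι (suc m) - ι (suc n)   ∎
    where
    ι-suc-cancel : ι (suc m) - ι (suc n) ≈ ι m - ι n
    ι-suc-cancel = begin
      ι (suc m) - ι (suc n)       ≈⟨ +-cong (1+× m 1#) (-‿cong (1+× n 1#)) ⟩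
      (1# + ι m) - (1# + ι n)     ≈⟨ +-congˡ (-‿+-comm 1# (ι n)) ⟨
      (1# + ι m) + (- 1# - ι n)   ≈⟨ +-assoc _ _ _ ⟨
      1# + ι m - 1# - ι n         ≈⟨ +-congʳ (xyx⁻¹≈y 1# (ι m)) ⟩
      ι m - ι n                   ∎

  +◃-homo : ∀ n → ⟦ Sign.+ ℤ.◃ n ⟧ℤ ≈ ι n
  +◃-homo zero = refl
  +◃-homo (suc n) = refl

  -◃-homo : ∀ n → ⟦ Sign.- ℤ.◃ n ⟧ℤ ≈ - ι n
  -◃-homo zero = sym -0#≈0#
  -◃-homo (suc n) = refl

  +-homo : ∀ i j → ⟦ i ℤ.+ j ⟧ℤ ≈ ⟦ i ⟧ℤ + ⟦ j ⟧ℤ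
  +-homo (+ m) (+ n) = ×-homo-+ 1# m n
  +-homo (+ m) -[1+ n ] = ⊖-homo m (suc n)
  +-homo -[1+ m ] (+ n) = trans (⊖-homo n (suc m)) (+-comm _ _)
  +-homo -[1+ m ] -[1+ n ] = begin
    - ι (suc (suc (m ℕ.+ n)))   ≡⟨ ≡.cong (λ k → - ι (suc k)) (ℕₚ.+-suc m n) ⟨
    - ι (suc m ℕ.+ suc n)       ≈⟨ -‿cong (×-homo-+ 1# (suc m) (suc n)) ⟩
    - (ι (suc m) + ι (suc n))   ≈⟨ -‿+-comm _ _ ⟨
    - ι (suc m) - ι (suc n)     ∎

  *-homo : ∀ i j → ⟦ i ℤ.* j ⟧ℤ ≈ ⟦ i ⟧ℤ * ⟦ j ⟧ℤ
  *-homo (+ m) (+ n) = trans (+◃-homo (m ℕ.* n)) (×1-homo-* m n)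
  *-homo (+ m) -[1+ n ] =
    trans (-◃-homo (m ℕ.* suc n)) (trans (-‿cong (×1-homo-* m (suc n))) (-‿distribʳ-* _ _))
  *-homo -[1+ m ] (+ n) =
    trans (-◃-homo (suc m ℕ.* n)) (trans (-‿cong (×1-homo-* (suc m) n)) (-‿distribˡ-* _ _))
  *-homo -[1+ m ] -[1+ n ] = begin
    ι (suc m ℕ.* suc n)          ≈⟨ ×1-homo-* (suc m) (suc n) ⟩
    ι (suc m) * ι (suc n)        ≈⟨ -‿involutive _ ⟨
    - - (ι (suc m) * ι (suc n))  ≈⟨ -‿cong (-‿distribˡ-* _ _) ⟩
    - (- ι (suc m) * ι (suc n))  ≈⟨ -‿distribʳ-* _ _ ⟩
    - ι (suc m) * - ι (suc n)    ∎

  -‿homo : ∀ i → ⟦ ℤ.- i ⟧ℤ ≈ - ⟦ i ⟧ℤ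
  -‿homo (+ zero) = sym -0#≈0#
  -‿homo (+ suc n) = refl
  -‿homo -[1+ n ] = sym (-‿involutive _)

  homomorphism : ℤ.+-*-rawRing -Raw-AlmostCommutative⟶ fromCommutativeRing R
  homomorphism = record
    { ⟦_⟧ = ⟦_⟧ℤ ; +-homo = +-homo ; *-homo = *-homo ; -‿homo = -‿homo
    ; 0-homo = refl ; 1-homo = refl }

  open import Algebra.Solver.Ring ℤ.+-*-rawRing (fromCommutativeRing R) homomorphism
    (λ i j → Maybe.map (reflexive ∘ ≡.cong ⟦_⟧ℤ) (dec⇒maybe (i ℤ.≟ j))) public

module Arithmetic where
  open import Data.Nat using (_+_; _*_; _/_)

  -- i (5i + 3 + 4J) is even, but no parity argument is needed: the division is only
  -- ever evaluated on numbers presented as i (5i + 3 + 4J) + 2d (e-shift).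
  e : ℕ → ℕ → ℕ
  e i J = i * (5 * i + 3 + 4 * J) / 2

  e-shift : ∀ {n} i J d → n ≡ i * (5 * i + 3 + 4 * J) + d * 2 → n / 2 ≡ e i J + d
  e-shift i J d ≡.refl = ≡.trans (+-distrib-/-∣ʳ (i * (5 * i + 3 + 4 * J)) (divides-refl d))
                                 (≡.cong (_+_ (e i J)) (m*n/n≡m d 2))

  numerator-sucʳ : ∀ i J →
    i * (5 * i + 3 + 4 * suc J) ≡ i * (5 * i + 3 + 4 * J) + (2 * i + 0 * J + 0) * 2
  numerator-sucʳ i J = solveℕ (i ∷ J ∷ [])

  numerator-sucˡ : ∀ i J →
    suc i * (5 * suc i + 3 + 4 * J) ≡ i * (5 * i + 3 + 4 * J) + (5 * i + 2 * J + 4) * 2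
  numerator-sucˡ i J = solveℕ (i ∷ J ∷ [])

  summand-numerator : ∀ r m k →
    m * (5 * (r + m) + 3 * r + 4 * k + 5)
      ≡ m * (5 * m + 3 + 4 * (2 * r + k)) + (1 * m + 0 * (2 * r + k) + 0) * 2
  summand-numerator r m k = solveℕ (r ∷ m ∷ k ∷ [])

  θ-numerator-pos : ∀ b i → ∣ + i ℤ.* (+ 5 ℤ.* + i ℤ.+ + b) ∣ ≡ i * (5 * i + b)
  θ-numerator-pos b i =
    ≡.trans (≡.cong (λ z → ∣ + i ℤ.* (z ℤ.+ + b) ∣) (≡.sym (ℤₚ.pos-* 5 i)))
            (≡.cong ∣_∣ (≡.sym (ℤₚ.pos-* i (5 * i + b))))

  5*-[1+i] : ∀ i → + 5 ℤ.* -[1+ i ] ≡ -[1+ 4 + 5 * i ]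
  5*-[1+i] i = ≡.cong -[1+_] (i + 4 * suc i ≡ 4 + 5 * i ∋ solveℕ (i ∷ []))

  θ₃-numerator-pos : ∀ i →
    ∣ + i ℤ.* (+ 5 ℤ.* + i ℤ.+ + 3) ∣ ≡ i * (5 * i + 3 + 4 * 0) + (0 * i + 0 * 0 + 0) * 2
  θ₃-numerator-pos i = ≡.trans (θ-numerator-pos 3 i) (solveℕ (i ∷ []))

  θ₁-numerator-pos : ∀ i →
    ∣ + suc i ℤ.* (+ 5 ℤ.* + suc i ℤ.+ + 1) ∣ ≡ i * (5 * i + 3 + 4 * 0) + (4 * i + 0 * 0 + 3) * 2
  θ₁-numerator-pos i = ≡.trans (θ-numerator-pos 1 (suc i)) (solveℕ (i ∷ []))

  θ₃-numerator-neg : ∀ i →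
    ∣ -[1+ i ] ℤ.* (+ 5 ℤ.* -[1+ i ] ℤ.+ + 3) ∣ ≡ i * (5 * i + 3 + 4 * 0) + (2 * i + 0 * 0 + 1) * 2
  θ₃-numerator-neg i = ≡.trans (≡.cong (λ z → ∣ -[1+ i ] ℤ.* (z ℤ.+ + 3) ∣) (5*-[1+i] i))
    (suc i * (2 + 5 * i) ≡ i * (5 * i + 3 + 4 * 0) + (2 * i + 0 * 0 + 1) * 2 ∋ solveℕ (i ∷ []))

  θ₁-numerator-neg : ∀ i →
    ∣ -[1+ i ] ℤ.* (+ 5 ℤ.* -[1+ i ] ℤ.+ + 1) ∣ ≡ i * (5 * i + 3 + 4 * 0) + (3 * i + 0 * 0 + 2) * 2
  θ₁-numerator-neg i = ≡.trans (≡.cong (λ z → ∣ -[1+ i ] ℤ.* (z ℤ.+ + 1) ∣) (5*-[1+i] i))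
    (suc i * (4 + 5 * i) ≡ i * (5 * i + 3 + 4 * 0) + (3 * i + 0 * 0 + 2) * 2 ∋ solveℕ (i ∷ []))

  2[1+r]+k : ∀ r k → 2 * suc r + k ≡ suc (suc (2 * r + k))
  2[1+r]+k r k = solveℕ (r ∷ k ∷ [])

  qratio-length : ∀ r m k → r + m + r + k ∸ m ≡ 2 * r + k
  qratio-length r m k =
    ≡.trans (≡.cong (_∸ m) (r + m + r + k ≡ m + (2 * r + k) ∋ solveℕ (r ∷ m ∷ k ∷ [])))
            (ℕₚ.m+n∸m≡n m (2 * r + k))

  -[1+n]+1≡-n : ∀ n → -[1+ n ] ℤ.+ + 1 ≡ ℤ.- + n
  -[1+n]+1≡-n zero = ≡.refl
  -[1+n]+1≡-n (suc n) = ≡.refl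

  -n+[1+2n]≡1+n : ∀ n → ℤ.- + n ℤ.+ + suc (n + n) ≡ + suc n
  -n+[1+2n]≡1+n n = ≡.trans (ℤₚ.-m+n≡n⊖m n (suc (n + n)))
    (≡.trans (ℤₚ.⊖-≥ (ℕₚ.m≤n+m n (suc n))) (≡.cong +_ (ℕₚ.m+n∸n≡m (suc n) n)))

module Proof {c ℓ : Level} (R : CommutativeRing c ℓ) (q : CommutativeRing.Carrier R) where
  open CommutativeRing R hiding (zero)
  open QDefs R q
  open ℤ-Coefficients R using (Polynomial; solve; _:=_; con; _:+_; _:*_; _:-_; :-_; _:^_)
  open Arithmetic
  open import Relation.Binary.Reasoning.Setoid setoid

  one zero′ : ∀ {n} → Polynomial n
  one = con (+ 1)
  zero′ = con (+ 0)

  pow-+ : ∀ x m n → pow x (m ℕ.+ n) ≈ pow x m * pow x n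
  pow-+ x zero n = sym (*-identityˡ _)
  pow-+ x (suc m) n = trans (*-congˡ (pow-+ x m n)) (sym (*-assoc _ _ _))

  pow-* : ∀ x m n → pow x (m ℕ.* n) ≈ pow (pow x n) m
  pow-* x zero n = refl
  pow-* x (suc m) n = trans (pow-+ x n (m ℕ.* n)) (*-congˡ (pow-* x m n))

  qp-half : ∀ {n} i J a b d →
            n ≡ i ℕ.* (5 ℕ.* i ℕ.+ 3 ℕ.+ 4 ℕ.* J) ℕ.+ (a ℕ.* i ℕ.+ b ℕ.* J ℕ.+ d) ℕ.* 2 →
            qp (n ℕ./ 2) ≈ qp (e i J) * (pow (qp i) a * pow (qp J) b * qp d)
  qp-half {n} i J a b d eq = begin
    qp (n ℕ./ 2)
      ≡⟨ ≡.cong qp (e-shift i J _ eq) ⟩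
    qp (e i J ℕ.+ (a ℕ.* i ℕ.+ b ℕ.* J ℕ.+ d))
      ≈⟨ trans (pow-+ q (e i J) _) (*-congˡ (pow-+ q (a ℕ.* i ℕ.+ b ℕ.* J) d)) ⟩
    qp (e i J) * (qp (a ℕ.* i ℕ.+ b ℕ.* J) * qp d)
      ≈⟨ *-congˡ (*-congʳ (trans (pow-+ q (a ℕ.* i) (b ℕ.* J))
                                 (*-cong (pow-* q a i) (pow-* q b J)))) ⟩
    qp (e i J) * (pow (qp i) a * pow (qp J) b * qp d)
      ∎

  qPoch : ℕ → ℕ → Carrier
  qPoch a zero = 1#
  qPoch a (suc n) = (1# - qp a) * qPoch (suc a) n

  qPoch-snoc : ∀ a n → qPoch a (suc n) ≈ qPoch a n * (1# - qp (a ℕ.+ n))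
  qPoch-snoc a zero = begin
    (1# - qp a) * 1#              ≈⟨ *-comm _ _ ⟩
    1# * (1# - qp a)              ≡⟨ ≡.cong (λ m → 1# * (1# - qp m)) (ℕₚ.+-identityʳ a) ⟨
    1# * (1# - qp (a ℕ.+ 0))      ∎
  qPoch-snoc a (suc n) = begin
    (1# - qp a) * qPoch (suc a) (suc n)
      ≈⟨ *-congˡ (qPoch-snoc (suc a) n) ⟩
    (1# - qp a) * (qPoch (suc a) n * (1# - qp (suc a ℕ.+ n)))
      ≈⟨ *-assoc _ _ _ ⟨
    qPoch a (suc n) * (1# - qp (suc a ℕ.+ n))
      ≡⟨ ≡.cong (λ m → qPoch a (suc n) * (1# - qp m)) (ℕₚ.+-suc a n) ⟨
    qPoch a (suc n) * (1# - qp (a ℕ.+ suc n))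
      ∎

  poch≈qPoch : ∀ a n → poch (qp a) n ≈ qPoch a n
  poch≈qPoch a n = trans (from 0 n) (reflexive (≡.cong (λ b → qPoch b n) (ℕₚ.+-identityʳ a)))
    where
    from : ∀ t n → prodL (map (λ j → 1# - qp a * qp j) (nrange t n)) ≈ qPoch (a ℕ.+ t) n
    from t zero = refl
    from t (suc n) = *-cong (+-congˡ (-‿cong (sym (pow-+ q a t))))
      (trans (from (suc t) n) (reflexive (≡.cong (λ b → qPoch b n) (ℕₚ.+-suc a t))))

  SchurRecurrence : (ℕ → Carrier) → Set ℓ
  SchurRecurrence x = ∀ J → x (suc (suc (suc J))) ≈ x (suc (suc J)) + qp (suc J) * x (suc J)

  -- All q-powers are written as products of qp i, qp J and q, so that the ring solver
  -- treats them as monomials in these three atoms.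
  module Contiguous
    (u : ℕ → ℕ → Carrier)
    (u-sucʳ : ∀ i J → u i (suc J) ≈ qp i * qp i * (1# - qp (suc i) * qp J) * u i J)
    (u-sucˡ : ∀ i J → (1# - qp (suc i)) * u (suc i) J
                        ≈ - (pow (qp (suc i)) 3 * qp J * qp (suc J) * u i (suc J)))
    where

    v : ℕ → ℕ → Carrier
    v i J = qp (suc i) * qp i * qp J * u i J

    α : ℕ → ℕ → Carrier
    α zero J = 0#
    α (suc m) J = α m J + (u m J - v m J)

    β : ℕ → ℕ → Carrier
    β m J = α m J + u m J

    u₀-sucʳ : ∀ J → u 0 J - v 0 J ≈ u 0 (suc J)
    u₀-sucʳ J = begin
      u 0 J - v 0 J
        ≈⟨ solve 3 (λ Q Y U → U :- Q :* one :* one :* Y :* U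
                              := one :* one :* (one :- Q :* one :* Y) :* U)
                   refl q (qp J) (u 0 J) ⟩
      qp 0 * qp 0 * (1# - qp 1 * qp J) * u 0 J
        ≈⟨ u-sucʳ 0 J ⟨
      u 0 (suc J)
        ∎

    u-sucˡ-split : ∀ i J → u (suc i) J
                     ≈ - v i (suc J) + qp (suc (suc J)) * u i (suc (suc J)) + qp (suc i) * u (suc i) J
    u-sucˡ-split i J = begin
      u (suc i) J
        ≈⟨ solve 3 (λ Q X U → U := (one :- Q :* X) :* U :+ Q :* X :* U)
                   refl q (qp i) (u (suc i) J) ⟩
      (1# - qp (suc i)) * u (suc i) J + qp (suc i) * u (suc i) J
        ≈⟨ +-congʳ (u-sucˡ i J) ⟩
      - (pow (qp (suc i)) 3 * qp J * qp (suc J) * u i (suc J)) + qp (suc i) * u (suc i) J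
        ≈⟨ +-congʳ (solve 4 (λ Q X Y U → :- ((Q :* X) :^ 3 :* Y :* (Q :* Y) :* U)
                     := :- (Q :* X :* X :* (Q :* Y) :* U)
                        :+ Q :* (Q :* Y) :* (X :* X :* (one :- Q :* X :* (Q :* Y)) :* U))
                     refl q (qp i) (qp J) (u i (suc J))) ⟩
      - v i (suc J) + qp (suc (suc J)) * (qp i * qp i * (1# - qp (suc i) * qp (suc J)) * u i (suc J))
          + qp (suc i) * u (suc i) J
        ≈⟨ +-congʳ (+-congˡ (*-congˡ (u-sucʳ i (suc J)))) ⟨
      - v i (suc J) + qp (suc (suc J)) * u i (suc (suc J)) + qp (suc i) * u (suc i) J
        ∎

    u-v-sucˡ : ∀ i J → qp (suc i) * u (suc i) J - v (suc i) J
                 ≈ u (suc i) (suc J) - qp (suc (suc J)) * v i (suc (suc J))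
    u-v-sucˡ i J = begin
      qp (suc i) * u (suc i) J - v (suc i) J
        ≈⟨ solve 4 (λ Q X Y U → Q :* X :* U :- Q :* (Q :* X) :* (Q :* X) :* Y :* U
                     := (Q :* X) :* (Q :* X) :* (one :- Q :* (Q :* X) :* Y) :* U
                        :+ Q :* X :* (one :- Q :* X :* (Q :* Y)) :* ((one :- Q :* X) :* U))
                     refl q (qp i) (qp J) (u (suc i) J) ⟩
      qp (suc i) * qp (suc i) * (1# - qp (suc (suc i)) * qp J) * u (suc i) J
        + qp (suc i) * (1# - qp (suc i) * qp (suc J)) * ((1# - qp (suc i)) * u (suc i) J)
        ≈⟨ +-cong (u-sucʳ (suc i) J) (*-congˡ (sym (u-sucˡ i J))) ⟨
      u (suc i) (suc J)
        + qp (suc i) * (1# - qp (suc i) * qp (suc J))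
            * - (pow (qp (suc i)) 3 * qp J * qp (suc J) * u i (suc J))
        ≈⟨ +-congˡ (solve 4 (λ Q X Y U →
                     Q :* X :* (one :- Q :* X :* (Q :* Y)) :* :- ((Q :* X) :^ 3 :* Y :* (Q :* Y) :* U)
                     := :- (Q :* (Q :* Y) :* (Q :* X :* X :* (Q :* (Q :* Y))
                              :* (X :* X :* (one :- Q :* X :* (Q :* Y)) :* U))))
                     refl q (qp i) (qp J) (u i (suc J))) ⟩
      u (suc i) (suc J)
        - qp (suc (suc J)) * (qp (suc i) * qp i * qp (suc (suc J))
                                * (qp i * qp i * (1# - qp (suc i) * qp (suc J)) * u i (suc J)))
        ≈⟨ +-congˡ (-‿cong (*-congˡ (*-congˡ (u-sucʳ i (suc J))))) ⟨
      u (suc i) (suc J) - qp (suc (suc J)) * v i (suc (suc J))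
        ∎

    α-suc : ∀ m J → α (suc m) J ≈ β m (suc J) + qp (suc (suc J)) * α m (suc (suc J))
    β-suc : ∀ m J → β (suc m) J
              ≈ α (suc m) (suc J) + qp (suc (suc J)) * β m (suc (suc J)) + qp (suc m) * u (suc m) J

    α-suc zero J = begin
      0# + (u 0 J - v 0 J)
        ≈⟨ +-congˡ (u₀-sucʳ J) ⟩
      0# + u 0 (suc J)
        ≈⟨ solve 2 (λ C U → zero′ :+ U := zero′ :+ U :+ C :* zero′)
                   refl (qp (suc (suc J))) (u 0 (suc J)) ⟩
      0# + u 0 (suc J) + qp (suc (suc J)) * 0#
        ∎
    α-suc (suc m) J = begin
      α (suc m) J + (u (suc m) J - v (suc m) J)
        ≈⟨ solve 3 (λ A U V → A :+ (U :- V) := A :+ U :- V) refl _ _ _ ⟩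
      β (suc m) J - v (suc m) J
        ≈⟨ +-congʳ (β-suc m J) ⟩
      α (suc m) (suc J) + C * β m (suc (suc J)) + qp (suc m) * u (suc m) J - v (suc m) J
        ≈⟨ solve 4 (λ A B W V → A :+ B :+ W :- V := A :+ B :+ (W :- V)) refl _ _ _ _ ⟩
      α (suc m) (suc J) + C * β m (suc (suc J)) + (qp (suc m) * u (suc m) J - v (suc m) J)
        ≈⟨ +-congˡ (u-v-sucˡ m J) ⟩
      α (suc m) (suc J) + C * β m (suc (suc J)) + (u (suc m) (suc J) - C * v m (suc (suc J)))
        ≈⟨ solve 6 (λ A C A₂ U₂ V₂ U → A :+ C :* (A₂ :+ U₂) :+ (U :- C :* V₂)
                     := A :+ U :+ C :* (A₂ :+ (U₂ :- V₂)))
                     refl (α (suc m) (suc J)) C (α m (suc (suc J))) (u m (suc (suc J)))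
                     (v m (suc (suc J))) (u (suc m) (suc J)) ⟩
      β (suc m) (suc J) + C * α (suc m) (suc (suc J))
        ∎
      where C = qp (suc (suc J))

    β-suc m J = begin
      α (suc m) J + u (suc m) J
        ≈⟨ +-cong (α-suc m J) (u-sucˡ-split m J) ⟩
      β m (suc J) + C * α m (suc (suc J))
        + (- v m (suc J) + C * u m (suc (suc J)) + qp (suc m) * u (suc m) J)
        ≈⟨ solve 7 (λ A₁ U₁ V₁ C A₂ U₂ W →
                     A₁ :+ U₁ :+ C :* A₂ :+ (:- V₁ :+ C :* U₂ :+ W)
                     := A₁ :+ (U₁ :- V₁) :+ C :* (A₂ :+ U₂) :+ W)
                     refl (α m (suc J)) (u m (suc J)) (v m (suc J)) C (α m (suc (suc J)))
                     (u m (suc (suc J))) (qp (suc m) * u (suc m) J) ⟩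
      α (suc m) (suc J) + C * β m (suc (suc J)) + qp (suc m) * u (suc m) J
        ∎
      where C = qp (suc (suc J))

    ρ : (ℕ → Carrier) → ℕ → ℕ → Carrier
    ρ x zero J = qp 0 * u 0 J * x (suc (suc J))
    ρ x (suc m) J = qp (suc m) * u (suc m) J * x (suc (suc J)) + ρ x m (suc (suc J))

    ρ-collapse : ∀ x → SchurRecurrence x →
                 ∀ m J → ρ x m J ≈ β m J * x (suc (suc J)) + qp (suc J) * α m (suc J) * x (suc J)
    ρ-collapse x x-rec zero J =
      solve 4 (λ U X₂ C X₁ → one :* U :* X₂ := (zero′ :+ U) :* X₂ :+ C :* zero′ :* X₁)
        refl (u 0 J) (x (suc (suc J))) (qp (suc J)) (x (suc J))
    ρ-collapse x x-rec (suc m) J = begin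
      W * x₂ + ρ x m (suc (suc J))
        ≈⟨ +-congˡ (ρ-collapse x x-rec m (suc (suc J))) ⟩
      W * x₂ + (B * x (suc (suc (suc (suc J)))) + C₃ * A * x (suc (suc (suc J))))
        ≈⟨ +-congˡ (+-cong (*-congˡ (trans (x-rec (suc J)) (+-congʳ (x-rec J))))
                           (*-congˡ (x-rec J))) ⟩
      W * x₂ + (B * ((x₂ + C₁ * x₁) + C₂ * x₂) + C₃ * A * (x₂ + C₁ * x₁))
        ≈⟨ solve 8 (λ W B A C₁ C₂ C₃ x₁ x₂ →
                     W :* x₂ :+ (B :* ((x₂ :+ C₁ :* x₁) :+ C₂ :* x₂)
                                 :+ C₃ :* A :* (x₂ :+ C₁ :* x₁))
                     := ((B :+ C₃ :* A) :+ C₂ :* B :+ W) :* x₂ :+ C₁ :* (B :+ C₃ :* A) :* x₁)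
                     refl W B A C₁ C₂ C₃ x₁ x₂ ⟩
      ((B + C₃ * A) + C₂ * B + W) * x₂ + C₁ * (B + C₃ * A) * x₁
        ≈⟨ +-cong (*-congʳ (+-congʳ (+-congʳ (α-suc m (suc J)))))
                  (*-congʳ (*-congˡ (α-suc m (suc J)))) ⟨
      (α (suc m) (suc J) + C₂ * B + W) * x₂ + C₁ * α (suc m) (suc J) * x₁
        ≈⟨ +-congʳ (*-congʳ (β-suc m J)) ⟨
      β (suc m) J * x₂ + C₁ * α (suc m) (suc J) * x₁
        ∎
      where
      W = qp (suc m) * u (suc m) J
      B = β m (suc (suc J))
      A = α m (suc (suc (suc J)))
      C₁ = qp (suc J)
      C₂ = qp (suc (suc J))
      C₃ = qp (suc (suc (suc J)))
      x₁ = x (suc J)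
      x₂ = x (suc (suc J))

  σ : ℕ → Carrier
  σ = pow (- 1#)

  u : ℕ → ℕ → Carrier
  u i J = σ i * qp (e i J) * qPoch (suc i) J

  u-sucʳ : ∀ i J → u i (suc J) ≈ qp i * qp i * (1# - qp (suc i) * qp J) * u i J
  u-sucʳ i J = begin
    σ i * qp (e i (suc J)) * qPoch (suc i) (suc J)
      ≈⟨ *-cong (*-congˡ (qp-half i J 2 0 0 (numerator-sucʳ i J))) (qPoch-snoc (suc i) J) ⟩
    σ i * (qp (e i J) * (pow (qp i) 2 * 1# * 1#)) * (qPoch (suc i) J * (1# - qp (suc i ℕ.+ J)))
      ≈⟨ *-congˡ (*-congˡ (+-congˡ (-‿cong (pow-+ q (suc i) J)))) ⟩
    σ i * (qp (e i J) * (pow (qp i) 2 * 1# * 1#)) * (qPoch (suc i) J * (1# - qp (suc i) * qp J))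
      ≈⟨ solve 6 (λ S E Q X Y P → S :* (E :* (X :^ 2 :* one :* one)) :* (P :* (one :- Q :* X :* Y))
                   := X :* X :* (one :- Q :* X :* Y) :* (S :* E :* P))
                   refl (σ i) (qp (e i J)) q (qp i) (qp J) (qPoch (suc i) J) ⟩
    qp i * qp i * (1# - qp (suc i) * qp J) * u i J
      ∎

  u-sucˡ : ∀ i J → (1# - qp (suc i)) * u (suc i) J
                     ≈ - (pow (qp (suc i)) 3 * qp J * qp (suc J) * u i (suc J))
  u-sucˡ i J = begin
    (1# - qp (suc i)) * (σ (suc i) * qp (e (suc i) J) * P)
      ≈⟨ *-congˡ (*-congʳ (*-congˡ (qp-half i J 5 2 4 (numerator-sucˡ i J)))) ⟩
    (1# - qp (suc i)) * (σ (suc i) * (qp (e i J) * (pow (qp i) 5 * pow (qp J) 2 * qp 4)) * P)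
      ≈⟨ solve 6 (λ S E Q X Y P →
                   (one :- Q :* X) :* ((:- one :* S) :* (E :* (X :^ 5 :* Y :^ 2 :* Q :^ 4)) :* P)
                   := :- ((Q :* X) :^ 3 :* Y :* (Q :* Y)
                          :* (S :* (E :* (X :^ 2 :* one :* one)) :* ((one :- Q :* X) :* P))))
                   refl (σ i) (qp (e i J)) q (qp i) (qp J) P ⟩
    - (pow (qp (suc i)) 3 * qp J * qp (suc J)
       * (σ i * (qp (e i J) * (pow (qp i) 2 * 1# * 1#)) * qPoch (suc i) (suc J)))
      ≈⟨ -‿cong (*-congˡ (*-congʳ (*-congˡ (qp-half i J 2 0 0 (numerator-sucʳ i J))))) ⟨
    - (pow (qp (suc i)) 3 * qp J * qp (suc J) * u i (suc J))
      ∎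
    where P = qPoch (suc (suc i)) J

  open Contiguous u u-sucʳ u-sucˡ

  θ : ℕ → ℤ → Carrier
  θ b j = sgn j * qp (∣ j ℤ.* (+ 5 ℤ.* j ℤ.+ + b) ∣ ℕ./ 2)

  θ₃-pos : ∀ i → θ 3 (+ i) ≈ u i 0
  θ₃-pos i = trans (*-congˡ (qp-half i 0 0 0 0 (θ₃-numerator-pos i)))
    (solve 2 (λ S E → S :* (E :* (one :* one :* one)) := S :* E :* one) refl (σ i) (qp (e i 0)))

  θ₃-neg : ∀ i → θ 3 -[1+ i ] ≈ - v i 0
  θ₃-neg i = trans (*-congˡ (qp-half i 0 2 0 1 (θ₃-numerator-neg i)))
    (solve 4 (λ S E Q X → (:- one :* S) :* (E :* (X :^ 2 :* one :* Q :^ 1))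
                          := :- (Q :* X :* X :* one :* (S :* E :* one)))
      refl (σ i) (qp (e i 0)) q (qp i))

  θ₁-zero : θ 1 (+ 0) ≈ u 0 0
  θ₁-zero = sym (*-identityʳ _)

  θ₁-neg : ∀ i → θ 1 -[1+ i ] ≈ - v i 0 + q * u i 1
  θ₁-neg i = trans (*-congˡ (qp-half i 0 3 0 2 (θ₁-numerator-neg i)))
    (trans (solve 4 (λ S E Q X → (:- one :* S) :* (E :* (X :^ 3 :* one :* Q :^ 2))
                                 := :- (Q :* X :* X :* one :* (S :* E :* one))
                                    :+ Q :* (X :* X :* (one :- Q :* X :* one) :* (S :* E :* one)))
             refl (σ i) (qp (e i 0)) q (qp i))
      (+-congˡ (*-congˡ (sym (u-sucʳ i 0)))))

  θ₁-pos : ∀ i → θ 1 (+ suc i) ≈ u (suc i) 0 - q * v i 1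
  θ₁-pos i = trans (*-congˡ (qp-half i 0 4 0 3 (θ₁-numerator-pos i)))
    (trans (solve 4 (λ S E Q X → (:- one :* S) :* (E :* (X :^ 4 :* one :* Q :^ 3))
                                 := (:- one :* S) :* (E :* (X :^ 5 :* one :^ 2 :* Q :^ 4)) :* one
                                    :- Q :* (Q :* X :* X :* (Q :* one)
                                             :* (X :* X :* (one :- Q :* X :* one) :* (S :* E :* one))))
             refl (σ i) (qp (e i 0)) q (qp i))
      (sym (+-cong (*-congʳ (*-congˡ (qp-half i 0 5 2 4 (numerator-sucˡ i 0))))
                   (-‿cong (*-congˡ (*-congˡ (u-sucʳ i 0)))))))

  Θ : ℕ → ℕ → Carrier
  Θ b n = sumL (map (θ b) (zrange (ℤ.- + n) (suc (n ℕ.+ n))))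

  sum-zrange-snoc : ∀ (f : ℤ → Carrier) a L →
                    sumL (map f (zrange a (suc L))) ≈ sumL (map f (zrange a L)) + f (a ℤ.+ + L)
  sum-zrange-snoc f a zero = begin
    f a + 0#              ≈⟨ +-comm _ _ ⟩
    0# + f a              ≡⟨ ≡.cong (λ j → 0# + f j) (ℤₚ.+-identityʳ a) ⟨
    0# + f (a ℤ.+ + 0)    ∎
  sum-zrange-snoc f a (suc L) = begin
    f a + sumL (map f (zrange (a ℤ.+ + 1) (suc L)))
      ≈⟨ +-congˡ (sum-zrange-snoc f (a ℤ.+ + 1) L) ⟩
    f a + (sumL (map f (zrange (a ℤ.+ + 1) L)) + f (a ℤ.+ + 1 ℤ.+ + L))
      ≈⟨ +-assoc _ _ _ ⟨
    f a + sumL (map f (zrange (a ℤ.+ + 1) L)) + f (a ℤ.+ + 1 ℤ.+ + L)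
      ≡⟨ ≡.cong (λ j → sumL (map f (zrange a (suc L))) + f j) (ℤₚ.+-assoc a (+ 1) (+ L)) ⟩
    f a + sumL (map f (zrange (a ℤ.+ + 1) L)) + f (a ℤ.+ + suc L)
      ∎

  Θ-suc : ∀ b n → Θ b (suc n) ≈ θ b -[1+ n ] + (Θ b n + θ b (+ suc n))
  Θ-suc b n = begin
    θ b -[1+ n ] + sumL (map (θ b) (zrange (-[1+ n ] ℤ.+ + 1) (suc (n ℕ.+ suc n))))
      ≡⟨ ≡.cong₂ (λ a L → θ b -[1+ n ] + sumL (map (θ b) (zrange a (suc L))))
                 (-[1+n]+1≡-n n) (ℕₚ.+-suc n n) ⟩
    θ b -[1+ n ] + sumL (map (θ b) (zrange (ℤ.- + n) (suc (suc (n ℕ.+ n)))))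
      ≈⟨ +-congˡ (sum-zrange-snoc (θ b) (ℤ.- + n) (suc (n ℕ.+ n))) ⟩
    θ b -[1+ n ] + (Θ b n + θ b (ℤ.- + n ℤ.+ + suc (n ℕ.+ n)))
      ≡⟨ ≡.cong (λ j → θ b -[1+ n ] + (Θ b n + θ b j)) (-n+[1+2n]≡1+n n) ⟩
    θ b -[1+ n ] + (Θ b n + θ b (+ suc n))
      ∎

  lhsSum-zero : ∀ b n → lhsSum b 0 n ≡ Θ b n
  lhsSum-zero b n =
    ≡.cong (λ m → sumL (map (θ b) (zrange (ℤ.- + m) (suc (n ℕ.+ m))))) (ℕₚ.+-identityʳ n)

  lhsSum-one : ∀ b n → lhsSum b 1 n ≡ θ b -[1+ n ] + Θ b n
  lhsSum-one b n = ≡.trans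
    (≡.cong (λ m → sumL (map (θ b) (zrange (ℤ.- + m) (suc (n ℕ.+ m))))) (ℕₚ.+-comm n 1))
    (≡.cong₂ (λ a L → θ b -[1+ n ] + sumL (map (θ b) (zrange a L)))
             (-[1+n]+1≡-n n) (ℕₚ.+-suc n n))

  Θ₃≈β : ∀ n → Θ 3 n ≈ β n 0
  Θ₃≈β zero = trans (+-identityʳ _) (trans (θ₃-pos 0) (sym (+-identityˡ _)))
  Θ₃≈β (suc n) = begin
    Θ 3 (suc n)
      ≈⟨ Θ-suc 3 n ⟩
    θ 3 -[1+ n ] + (Θ 3 n + θ 3 (+ suc n))
      ≈⟨ +-cong (θ₃-neg n) (+-cong (Θ₃≈β n) (θ₃-pos (suc n))) ⟩
    - v n 0 + (β n 0 + u (suc n) 0)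
      ≈⟨ solve 4 (λ V A U U′ → :- V :+ (A :+ U :+ U′) := A :+ (U :- V) :+ U′)
                 refl (v n 0) (α n 0) (u n 0) (u (suc n) 0) ⟩
    β (suc n) 0
      ∎

  Θ₁≈β+qα : ∀ n → Θ 1 n ≈ β n 0 + q * α n 1
  Θ₁≈β+qα zero = trans (+-identityʳ _) (trans θ₁-zero
    (solve 2 (λ U Q → U := zero′ :+ U :+ Q :* zero′) refl (u 0 0) q))
  Θ₁≈β+qα (suc n) = begin
    Θ 1 (suc n)
      ≈⟨ Θ-suc 1 n ⟩
    θ 1 -[1+ n ] + (Θ 1 n + θ 1 (+ suc n))
      ≈⟨ +-cong (θ₁-neg n) (+-cong (Θ₁≈β+qα n) (θ₁-pos n)) ⟩
    - v n 0 + q * u n 1 + (β n 0 + q * α n 1 + (u (suc n) 0 - q * v n 1))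
      ≈⟨ solve 8 (λ Q V₀ U₀ A₀ V₁ U₁ A₁ U′ →
                   :- V₀ :+ Q :* U₁ :+ (A₀ :+ U₀ :+ Q :* A₁ :+ (U′ :- Q :* V₁))
                   := A₀ :+ (U₀ :- V₀) :+ U′ :+ Q :* (A₁ :+ (U₁ :- V₁)))
                   refl q (v n 0) (u n 0) (α n 0) (v n 1) (u n 1) (α n 1) (u (suc n) 0) ⟩
    β (suc n) 0 + q * α (suc n) 1
      ∎

  summand : (ℕ → Carrier) → ℕ → ℕ → ℕ → Carrier
  summand x k n r =
    x (2 ℕ.* r ℕ.+ k ℕ.+ 2) * pow (- 1#) (n ∸ r)
      * qp (((n ∸ r) ℕ.* (5 ℕ.* n ℕ.+ 3 ℕ.* r ℕ.+ 4 ℕ.* k ℕ.+ 5)) ℕ./ 2)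
      * qratio (n ℕ.+ r ℕ.+ k) (n ∸ r)

  summand≈qu : ∀ x k r m → let J = 2 ℕ.* r ℕ.+ k in
               summand x k (r ℕ.+ m) r ≈ qp m * u m J * x (suc (suc J))
  summand≈qu x k r m rewrite ℕₚ.m+n∸m≡n r m = begin
    x (J ℕ.+ 2) * σ m * qp ((m ℕ.* (5 ℕ.* (r ℕ.+ m) ℕ.+ 3 ℕ.* r ℕ.+ 4 ℕ.* k ℕ.+ 5)) ℕ./ 2)
      * poch (qp (suc m)) (r ℕ.+ m ℕ.+ r ℕ.+ k ∸ m)
      ≈⟨ *-cong (*-cong (*-congʳ (reflexive (≡.cong x (ℕₚ.+-comm J 2))))
                        (qp-half m J 1 0 0 (summand-numerator r m k)))
                (trans (reflexive (≡.cong (poch (qp (suc m))) (qratio-length r m k)))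
                       (poch≈qPoch (suc m) J)) ⟩
    x (suc (suc J)) * σ m * (qp (e m J) * (pow (qp m) 1 * 1# * 1#)) * qPoch (suc m) J
      ≈⟨ solve 5 (λ X₂ S E M P → X₂ :* S :* (E :* (M :^ 1 :* one :* one)) :* P
                                 := M :* (S :* E :* P) :* X₂)
                 refl (x (suc (suc J))) (σ m) (qp (e m J)) (qp m) (qPoch (suc m) J) ⟩
    qp m * u m J * x (suc (suc J))
      ∎
    where J = 2 ℕ.* r ℕ.+ k

  summands≈ρ : ∀ x k m r {n} → n ≡ r ℕ.+ m →
                  sumL (map (summand x k n) (nrange r (suc m))) ≈ ρ x m (2 ℕ.* r ℕ.+ k)
  summands≈ρ x k zero r ≡.refl = trans (+-identityʳ _) (summand≈qu x k r 0)
  summands≈ρ x k (suc m) r ≡.refl = +-cong (summand≈qu x k r (suc m)) (begin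
    sumL (map (summand x k (r ℕ.+ suc m)) (nrange (suc r) (suc m)))
      ≈⟨ summands≈ρ x k m (suc r) (ℕₚ.+-suc r m) ⟩
    ρ x m (2 ℕ.* suc r ℕ.+ k)
      ≡⟨ ≡.cong (ρ x m) (2[1+r]+k r k) ⟩
    ρ x m (suc (suc (2 ℕ.* r ℕ.+ k)))
      ∎)

  rhsSum-collapse : ∀ x → SchurRecurrence x → ∀ k n →
                    rhsSum x k n ≈ β n k * x (suc (suc k)) + qp (suc k) * α n (suc k) * x (suc k)
  rhsSum-collapse x x-rec k n = trans (summands≈ρ x k n 0 ≡.refl) (ρ-collapse x x-rec n k)

  e-identity : ∀ {k} → k ≤ 1 → ∀ n → lhsSum 1 k n ≈ rhsSum schurE k n
  e-identity z≤n n = begin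
    lhsSum 1 0 n
      ≡⟨ lhsSum-zero 1 n ⟩
    Θ 1 n
      ≈⟨ Θ₁≈β+qα n ⟩
    β n 0 + q * α n 1
      ≈⟨ solve 3 (λ B Q A → B :+ Q :* A := B :* one :+ Q :^ 1 :* A :* one) refl (β n 0) q (α n 1) ⟩
    β n 0 * schurE 2 + qp 1 * α n 1 * schurE 1
      ≈⟨ rhsSum-collapse schurE (λ _ → refl) 0 n ⟨
    rhsSum schurE 0 n
      ∎
  e-identity (s≤s z≤n) n = begin
    lhsSum 1 1 n
      ≡⟨ lhsSum-one 1 n ⟩
    θ 1 -[1+ n ] + Θ 1 n
      ≈⟨ +-cong (θ₁-neg n) (Θ₁≈β+qα n) ⟩
    - v n 0 + q * u n 1 + (β n 0 + q * α n 1)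
      ≈⟨ solve 6 (λ Q V₀ U₀ A₀ U₁ A₁ → :- V₀ :+ Q :* U₁ :+ (A₀ :+ U₀ :+ Q :* A₁)
                                        := A₀ :+ (U₀ :- V₀) :+ Q :* (A₁ :+ U₁))
                 refl q (v n 0) (u n 0) (α n 0) (u n 1) (α n 1) ⟩
    α (suc n) 0 + q * β n 1
      ≈⟨ +-congʳ (α-suc n 0) ⟩
    β n 1 + qp 2 * α n 2 + q * β n 1
      ≈⟨ solve 4 (λ B C A Q → B :+ C :* A :+ Q :* B
                              := B :* (one :+ Q :^ 1 :* one) :+ C :* A :* one)
                 refl (β n 1) (qp 2) (α n 2) q ⟩
    β n 1 * schurE 3 + qp 2 * α n 2 * schurE 2
      ≈⟨ rhsSum-collapse schurE (λ _ → refl) 1 n ⟨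
    rhsSum schurE 1 n
      ∎

  d-identity : ∀ {k} → k ≤ 1 → ∀ n → lhsSum 3 k n ≈ rhsSum schurD k n
  d-identity z≤n n = begin
    lhsSum 3 0 n
      ≡⟨ lhsSum-zero 3 n ⟩
    Θ 3 n
      ≈⟨ Θ₃≈β n ⟩
    β n 0
      ≈⟨ solve 3 (λ B Q A → B := B :* one :+ Q :^ 1 :* A :* zero′) refl (β n 0) q (α n 1) ⟩
    β n 0 * schurD 2 + qp 1 * α n 1 * schurD 1
      ≈⟨ rhsSum-collapse schurD (λ _ → refl) 0 n ⟨
    rhsSum schurD 0 n
      ∎
  d-identity (s≤s z≤n) n = begin
    lhsSum 3 1 n
      ≡⟨ lhsSum-one 3 n ⟩
    θ 3 -[1+ n ] + Θ 3 n
      ≈⟨ +-cong (θ₃-neg n) (Θ₃≈β n) ⟩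
    - v n 0 + β n 0
      ≈⟨ solve 3 (λ V A U → :- V :+ (A :+ U) := A :+ (U :- V)) refl (v n 0) (α n 0) (u n 0) ⟩
    α (suc n) 0
      ≈⟨ α-suc n 0 ⟩
    β n 1 + qp 2 * α n 2
      ≈⟨ solve 4 (λ B C A Q → B :+ C :* A := B :* (one :+ Q :^ 1 :* zero′) :+ C :* A :* one)
                 refl (β n 1) (qp 2) (α n 2) q ⟩
    β n 1 * schurD 3 + qp 2 * α n 2 * schurD 2
      ≈⟨ rhsSum-collapse schurD (λ _ → refl) 1 n ⟨
    rhsSum schurD 1 n
      ∎

theorem1p1 : ∀ {c ℓ : Level} (R : CommutativeRing c ℓ) (q : CommutativeRing.Carrier R)
    (k : ℕ) → k ≤ 1 → (n : ℕ) →
    CommutativeRing._≈_ R (QDefs.lhsSum R q 1 k n) (QDefs.rhsSum R q (QDefs.schurE R q) k n)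
    × CommutativeRing._≈_ R (QDefs.lhsSum R q 3 k n) (QDefs.rhsSum R q (QDefs.schurD R q) k n)
theorem1p1 R q k k≤1 n = e-identity k≤1 n , d-identity k≤1 n
  where open Proof R q
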